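{- For all positive integers $n,d$, $$\det V(n,d)=\prod_{i=1}^{\min\{n,d\}}\left(\det W_i\right)^{\binom{n}{i}},$$ where $W_i=[(\gamma^a)^{\gamma^b}]_{a,b=1}^{q_i}$ is the power-product matrix of all $i$-compositions $\gamma^1,\dots,\gamma^{q_i}$ of $d$ (all $\gamma\in(\mathbb{N}^*)^i$ with $\gamma_1+\cdots+\gamma_i=d$, $q_i=\binom{d-1}{i-1}$), listed in any fixed order.
   Context: $\mathbb{N}=\{0,1,2,\dots\}$, $\mathbb{N}^*$ the positive integers; $B(n,d)=\{\alpha\in\mathbb{N}^n:\sum_i\alpha_i=d\}$ enumerated in any order as $\alpha^1,\dots,\alpha^s$; $V(n,d)=[(\alpha^i)^{\alpha^j}]_{i,j}$ where $\alpha^{\beta}=\prod_k\alpha_k^{\beta_k}$ and $0^0=1$ (the determinant does not depend on the enumeration, since reordering permutes rows and columns simultaneously). -}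

module Defs where

open import Data.Nat as ℕ using (ℕ; zero; suc; _∸_)
open import Data.Nat.Combinatorics using (_C_)
open import Data.Integer as ℤ using (ℤ; +_; -_)
open import Data.Fin using (Fin; zero; suc; punchIn; toℕ)
open import Data.List as List using (List; []; _∷_; length; lookup; upTo; allFin; concatMap; map)
open import Data.Vec as Vec using (Vec; []; _∷_; zipWith)

sumℤ : List ℤ → ℤ
sumℤ = List.foldr ℤ._+_ (+ 0)

prodℤ : List ℤ → ℤ
prodℤ = List.foldr ℤ._*_ (+ 1)

det : (m : ℕ) → (Fin m → Fin m → ℤ) → ℤ
det zero M = + 1
det (suc m) M =
  sumℤ (List.map (λ j → ((- + 1) ℤ.^ toℕ j) ℤ.* (M zero j ℤ.* det m (λ r c → M (suc r) (punchIn j c))))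
                 (allFin (suc m)))

-- α^β = ∏_k α_k^{β_k}, with 0^0 = 1 (as for ℕ._^_)
powProd : {n : ℕ} → Vec ℕ n → Vec ℕ n → ℕ
powProd α β = Vec.foldr _ ℕ._*_ 1 (zipWith ℕ._^_ α β)

powMatrix : {n : ℕ} (L : List (Vec ℕ n)) → Fin (length L) → Fin (length L) → ℤ
powMatrix L i j = + powProd (lookup L i) (lookup L j)

-- B(n,d): all α ∈ ℕ^n with α_1+…+α_n = d (a fixed enumeration, without repetition)
B : (n d : ℕ) → List (Vec ℕ n)
B zero zero = [] ∷ []
B zero (suc d) = []
B (suc n) d = concatMap (λ k → map (k ∷_) (B n (d ∸ k))) (upTo (suc d))

Comp : (i d : ℕ) → List (Vec ℕ i)
Comp zero zero = [] ∷ []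
Comp zero (suc d) = []
Comp (suc i) d = concatMap (λ k → map (suc k ∷_) (Comp i (d ∸ suc k))) (upTo d)

V : (n d : ℕ) → Fin (length (B n d)) → Fin (length (B n d)) → ℤ
V n d = powMatrix (B n d)

W : (i d : ℕ) → Fin (length (Comp i d)) → Fin (length (Comp i d)) → ℤ
W i d = powMatrix (Comp i d)

detV : ℕ → ℕ → ℤ
detV n d = det (length (B n d)) (V n d)

detW : ℕ → ℕ → ℤ
detW i d = det (length (Comp i d)) (W i d)

-- Consider more generally the power-product matrix of the compositions of d in which a
-- prescribed set of parts must be positive (none for V(n,d), all for W_i). Splitting an
-- unconstrained part t into the cases "= 0" and "≥ 1" sorts these compositions into two
-- families, the first a copy of the family with part t deleted. Since α^β = 0 when
-- α_t = 0 < β_t, after a simultaneous permutation of rows and columns the matrix is block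
-- triangular, so the determinant D(c, z) for c positive and z unconstrained parts obeys
-- Pascal's recursion D(c, z + 1) = D(c, z) · D(c + 1, z). Hence
-- det V(n,d) = D(0, n) = ∏_i D(i, 0)^(n C i) = ∏_i (det W_i)^(n C i), and W_i is empty for i > d.
module Submission where

open import Defs
open import Data.Nat as ℕ using (ℕ; zero; suc; _∸_; _≤_; _<_; s≤s; z≤n; _⊓_)
open import Data.Nat.Combinatorics using (_C_; nCk+nC[k+1]≡[n+1]C[k+1])
open import Data.Integer as ℤ using (ℤ; +_; -_; _+_; _*_; _^_; 0ℤ; 1ℤ)
import Data.Integer.Properties as ℤP
open import Data.Integer.Tactic.RingSolver using (solve-∀)
open import Data.Fin as Fin using (Fin; zero; suc; punchIn; toℕ; _↑ˡ_; _↑ʳ_; cast)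
open import Data.Fin.Permutation using (permutation)
open import Data.Product as Product using (_×_; _,_; proj₁; proj₂; uncurry)
open import Data.Bool using (Bool; true; false)
open import Data.Empty using (⊥)
open import Data.List as List using (List; []; _∷_; _++_; length; lookup; map; allFin; concatMap; upTo; applyUpTo; replicate)
open import Data.Sum using (inj₁; inj₂)
open import Data.Vec as Vec using (Vec; []; _∷_)
open import Data.List.Relation.Unary.All as All using (All)
import Data.List.Relation.Unary.All.Properties as AllP
import Data.List.Relation.Binary.Permutation.Propositional.Properties as ↭P
open import Data.List.Membership.Propositional using (_∈_)
open import Data.List.Membership.Propositional.Properties using (∈-lookup; ∈-map⁻)
open import Data.List.Relation.Binary.Permutation.Propositional as ↭ using (_↭_)
import Data.Fin.Properties as FinP
import Data.Nat.Properties as ℕP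
import Data.List.Properties as LP
open import Function using (_∘_; id)
open import Relation.Binary.PropositionalEquality
open import Algebra.Properties.Semiring.Sum ℤP.+-*-semiring
  using (sum; sum-syntax; sum-cong-≗; sum-replicate-zero; ∑-permute; ∑-distrib-+; *-distribˡ-sum; *-distribʳ-sum)

-- Laplace expansion

SqMatrix : ℕ → Set
SqMatrix m = Fin m → Fin m → ℤ

sign : ∀ {n} → Fin n → ℤ
sign zero    = 1ℤ
sign (suc j) = - sign j

minor : ∀ {m} → SqMatrix (suc m) → Fin (suc m) → SqMatrix m
minor M j r c = M (suc r) (punchIn j c)

det′ : ∀ {m} → SqMatrix m → ℤ
det′ {zero}  M = 1ℤ
det′ {suc m} M = ∑[ j < suc m ] (sign j * (M zero j * det′ (minor M j)))

det′-cong : ∀ {m} {M N : SqMatrix m} → (∀ i j → M i j ≡ N i j) → det′ M ≡ det′ N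
det′-cong {zero}  M≗N = refl
det′-cong {suc m} M≗N = sum-cong-≗ λ j →
  cong₂ (λ x y → sign j * (x * y)) (M≗N zero j) (det′-cong λ r c → M≗N (suc r) (punchIn j c))

sumℤ-tabulate : ∀ {n} (f : Fin n → ℤ) → sumℤ (List.tabulate f) ≡ sum f
sumℤ-tabulate {zero}  f = refl
sumℤ-tabulate {suc n} f = cong (_+_ (f zero)) (sumℤ-tabulate (f ∘ suc))

-1^toℕ≡sign : ∀ {n} (j : Fin n) → (- 1ℤ) ^ toℕ j ≡ sign j
-1^toℕ≡sign zero    = refl
-1^toℕ≡sign (suc j) = trans (ℤP.-1*i≡-i _) (cong -_ (-1^toℕ≡sign j))

det≡det′ : ∀ m (M : SqMatrix m) → det m M ≡ det′ M
det≡det′ zero    M = refl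
det≡det′ (suc m) M = begin
  sumℤ (List.map term (allFin (suc m))) ≡⟨ cong sumℤ (LP.map-tabulate id term) ⟩
  sumℤ (List.tabulate term)             ≡⟨ sumℤ-tabulate term ⟩
  sum term                              ≡⟨ sum-cong-≗ (λ j → cong₂ (λ s d → s * (M zero j * d))
                                             (-1^toℕ≡sign j) (det≡det′ m (minor M j))) ⟩
  det′ M                                ∎
  where
  open ≡-Reasoning
  term : Fin (suc m) → ℤ
  term j = (- 1ℤ) ^ toℕ j * (M zero j * det m (minor M j))

sum-neg : ∀ {n} (f : Fin n → ℤ) → ∑[ i < n ] (- f i) ≡ - sum f
sum-neg {zero}  f = refl
sum-neg {suc n} f = trans (cong (_+_ (- f zero)) (sum-neg (f ∘ suc))) (sym (ℤP.neg-distrib-+ (f zero) _))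

sum-zero : ∀ {n} (f : Fin n → ℤ) → (∀ i → f i ≡ 0ℤ) → sum f ≡ 0ℤ
sum-zero {n} f f≗0 = trans (sum-cong-≗ f≗0) (sum-replicate-zero n)

sum-↑ : ∀ m n (f : Fin (m ℕ.+ n) → ℤ) → sum f ≡ ∑[ i < m ] f (i ↑ˡ n) + ∑[ j < n ] f (m ↑ʳ j)
sum-↑ zero    n f = sym (ℤP.+-identityˡ _)
sum-↑ (suc m) n f = trans (cong (_+_ (f zero)) (sum-↑ m n (f ∘ suc))) (sym (ℤP.+-assoc (f zero) _ _))

neg-distribʳ-*² : ∀ a b c → - (a * (b * c)) ≡ a * (b * - c)
neg-distribʳ-*² a b c = trans (ℤP.neg-distribʳ-* a (b * c)) (cong (a *_) (ℤP.neg-distribʳ-* b c))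

*-distribˡ-sum₂ : ∀ {n} a b (f : Fin n → ℤ) → a * (b * sum f) ≡ ∑[ i < n ] (a * (b * f i))
*-distribˡ-sum₂ a b f = trans (cong (a *_) (*-distribˡ-sum b f)) (*-distribˡ-sum a (λ i → b * f i))

-- Adjacent transpositions and block triangular matrices

adjSwap : ∀ {k} → Fin (suc k) → Fin (suc (suc k)) → Fin (suc (suc k))
adjSwap         zero    zero          = suc zero
adjSwap         zero    (suc zero)    = zero
adjSwap         zero    (suc (suc x)) = suc (suc x)
adjSwap {suc k} (suc c) zero          = zero
adjSwap {suc k} (suc c) (suc x)       = suc (adjSwap c x)

adjSwap-involutive : ∀ {k} (c : Fin (suc k)) x → adjSwap c (adjSwap c x) ≡ x
adjSwap-involutive         zero    zero          = refl
adjSwap-involutive         zero    (suc zero)    = refl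
adjSwap-involutive         zero    (suc (suc x)) = refl
adjSwap-involutive {suc k} (suc c) zero          = refl
adjSwap-involutive {suc k} (suc c) (suc x)       = cong suc (adjSwap-involutive c x)

sum-adjSwap : ∀ {k} (c : Fin (suc k)) (f : Fin (suc (suc k)) → ℤ) → ∑[ j < suc (suc k) ] f (adjSwap c j) ≡ sum f
sum-adjSwap c f = sym (∑-permute f (permutation (adjSwap c) (adjSwap c) (adjSwap-involutive c) (adjSwap-involutive c)))

-- (j , k) encodes the ordered pair of distinct positions (j , punchIn j k);
-- exchange j k encodes the reversed pair (punchIn j k , j).
exchange : ∀ {N} → Fin (suc N) → Fin N → Fin (suc N) × Fin N
exchange {suc N} zero    k       = suc k , zero
exchange {suc N} (suc j) zero    = zero , j
exchange {suc N} (suc j) (suc k) = Product.map suc suc (exchange j k)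

exchange-first : ∀ {N} (j : Fin (suc N)) k → proj₁ (exchange j k) ≡ punchIn j k
exchange-first {suc N} zero    k       = refl
exchange-first {suc N} (suc j) zero    = refl
exchange-first {suc N} (suc j) (suc k) = cong suc (exchange-first j k)

exchange-second : ∀ {N} (j : Fin (suc N)) k → uncurry punchIn (exchange j k) ≡ j
exchange-second {suc N} zero    k       = refl
exchange-second {suc N} (suc j) zero    = refl
exchange-second {suc N} (suc j) (suc k) = cong suc (exchange-second j k)

exchange-punchIn² : ∀ {N} (j : Fin (suc (suc N))) k (x : Fin N) →
  punchIn (proj₁ (exchange j k)) (punchIn (proj₂ (exchange j k)) x) ≡ punchIn j (punchIn k x)
exchange-punchIn² zero    k                x       = refl
exchange-punchIn² (suc j) zero             x       = refl
exchange-punchIn² {suc N} (suc j) (suc k) zero    = refl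
exchange-punchIn² {suc N} (suc j) (suc k) (suc x) = cong suc (exchange-punchIn² j k x)

exchange-sign : ∀ {N} (j : Fin (suc N)) k →
  uncurry (λ a b → sign a * sign b) (exchange j k) ≡ - (sign j * sign k)
exchange-sign {suc N} zero    k       = lemma (sign k)
  where lemma : ∀ a → - a * + 1 ≡ - (+ 1 * a)
        lemma = solve-∀
exchange-sign {suc N} (suc j) zero    = lemma (sign j)
  where lemma : ∀ a → + 1 * a ≡ - (- a * + 1)
        lemma = solve-∀
exchange-sign {suc N} (suc j) (suc k) = begin
  - sign a * - sign b      ≡⟨ neg*neg (sign a) (sign b) ⟩
  sign a * sign b          ≡⟨ exchange-sign j k ⟩
  - (sign j * sign k)      ≡⟨ cong -_ (neg*neg (sign j) (sign k)) ⟨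
  - (- sign j * - sign k)  ∎
  where
  open ≡-Reasoning
  a : Fin (suc N)
  a = proj₁ (exchange j k)
  b : Fin N
  b = proj₂ (exchange j k)
  neg*neg : ∀ x y → - x * - y ≡ x * y
  neg*neg = solve-∀

sum-exchange : ∀ N (F : Fin (suc N) → Fin N → ℤ) →
  ∑[ j < suc N ] ∑[ k < N ] F j k ≡ ∑[ j < suc N ] ∑[ k < N ] uncurry F (exchange j k)
sum-exchange zero    F = refl
sum-exchange (suc N) F = begin
  ∑₀ + ∑[ j < suc N ] (F (suc j) zero + ∑[ k < N ] F (suc j) (suc k))
    ≡⟨ cong (_+_ ∑₀) (∑-distrib-+ (λ j → F (suc j) zero) (λ j → ∑[ k < N ] F (suc j) (suc k))) ⟩
  ∑₀ + (∑ᶜ + ∑[ j < suc N ] ∑[ k < N ] F (suc j) (suc k))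
    ≡⟨ cong (λ s → ∑₀ + (∑ᶜ + s)) (sum-exchange N (λ j k → F (suc j) (suc k))) ⟩
  ∑₀ + (∑ᶜ + ∑ᵉ)
    ≡⟨ +-exchange ∑₀ ∑ᶜ ∑ᵉ ⟩
  ∑ᶜ + (∑₀ + ∑ᵉ)
    ≡⟨ cong (_+_ ∑ᶜ) (∑-distrib-+ (F zero) (λ j → ∑[ k < N ] uncurry F (Product.map suc suc (exchange j k)))) ⟨
  ∑ᶜ + ∑[ j < suc N ] (F zero j + ∑[ k < N ] uncurry F (Product.map suc suc (exchange j k)))
    ∎
  where
  open ≡-Reasoning
  ∑₀ = ∑[ k < suc N ] F zero k
  ∑ᶜ = ∑[ j < suc N ] F (suc j) zero
  ∑ᵉ = ∑[ j < suc N ] ∑[ k < N ] uncurry F (Product.map suc suc (exchange j k))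
  +-exchange : ∀ a b c → a + (b + c) ≡ b + (a + c)
  +-exchange = solve-∀

twoRowTerm : ∀ {k} → SqMatrix (suc (suc k)) → Fin (suc (suc k)) → Fin (suc k) → ℤ
twoRowTerm M j l = sign j * (M zero j * (sign l * (M (suc zero) (punchIn j l) * det′ (minor (minor M j) l))))

det′-expand₂ : ∀ {k} (M : SqMatrix (suc (suc k))) →
  det′ M ≡ ∑[ j < suc (suc k) ] ∑[ l < suc k ] twoRowTerm M j l
det′-expand₂ M = sum-cong-≗ λ j → *-distribˡ-sum₂ (sign j) (M zero j)
  (λ l → sign l * (M (suc zero) (punchIn j l) * det′ (minor (minor M j) l)))

twoRowTerm-exchange : ∀ {k} (M : SqMatrix (suc (suc k))) j l →
  uncurry (twoRowTerm (M ∘ adjSwap zero)) (exchange j l) ≡ - twoRowTerm M j l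
twoRowTerm-exchange {k} M j l = begin
  sign a * (M (suc zero) a * (sign b * (M zero (punchIn a b) * D a b)))
    ≡⟨ cong₂ (λ x y → sign a * (M (suc zero) x * (sign b * (M zero (punchIn a b) * y))))
         (exchange-first j l) (det′-cong λ r c → cong (M (suc (suc r))) (exchange-punchIn² j l c)) ⟩
  sign a * (M (suc zero) (punchIn j l) * (sign b * (M zero (punchIn a b) * D j l)))
    ≡⟨ cong (λ y → sign a * (M (suc zero) (punchIn j l) * (sign b * (M zero y * D j l)))) (exchange-second j l) ⟩
  sign a * (M (suc zero) (punchIn j l) * (sign b * (M zero j * D j l)))
    ≡⟨ reorder (sign a) (sign b) (sign j) (sign l) (M (suc zero) (punchIn j l)) (M zero j) (D j l)
         (exchange-sign j l) ⟩
  - twoRowTerm M j l ∎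
  where
  open ≡-Reasoning
  a : Fin (suc (suc k))
  a = proj₁ (exchange j l)
  b : Fin (suc k)
  b = proj₂ (exchange j l)
  D : Fin (suc (suc k)) → Fin (suc k) → ℤ
  D x y = det′ (minor (minor M x) y)
  reorder : ∀ sa sb sj sl x y d → sa * sb ≡ - (sj * sl) →
            sa * (x * (sb * (y * d))) ≡ - (sj * (y * (sl * (x * d))))
  reorder sa sb sj sl x y d eq = begin
    sa * (x * (sb * (y * d)))     ≡⟨ gather sa sb x y d ⟩
    (sa * sb) * (x * (y * d))     ≡⟨ cong (_* (x * (y * d))) eq ⟩
    - (sj * sl) * (x * (y * d))   ≡⟨ scatter sj sl x y d ⟩
    - (sj * (y * (sl * (x * d)))) ∎
    where
    gather : ∀ sa sb x y d → sa * (x * (sb * (y * d))) ≡ (sa * sb) * (x * (y * d))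
    gather = solve-∀
    scatter : ∀ sj sl x y d → - (sj * sl) * (x * (y * d)) ≡ - (sj * (y * (sl * (x * d))))
    scatter = solve-∀

-- For c = 0 expand along the two swapped rows: exchanging the two columns they use undoes
-- the swap, at the cost of a sign.
det′-swapRows : ∀ {k} (c : Fin (suc k)) (M : SqMatrix (suc (suc k))) → det′ (M ∘ adjSwap c) ≡ - det′ M
det′-swapRows {k} zero M = begin
  det′ (M ∘ adjSwap zero)
    ≡⟨ det′-expand₂ (M ∘ adjSwap zero) ⟩
  ∑[ j < suc (suc k) ] ∑[ l < suc k ] twoRowTerm (M ∘ adjSwap zero) j l
    ≡⟨ sum-exchange (suc k) (twoRowTerm (M ∘ adjSwap zero)) ⟩
  ∑[ j < suc (suc k) ] ∑[ l < suc k ] uncurry (twoRowTerm (M ∘ adjSwap zero)) (exchange j l)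
    ≡⟨ sum-cong-≗ (λ j → sum-cong-≗ (twoRowTerm-exchange M j)) ⟩
  ∑[ j < suc (suc k) ] ∑[ l < suc k ] (- twoRowTerm M j l)
    ≡⟨ sum-cong-≗ (λ j → sum-neg (twoRowTerm M j)) ⟩
  ∑[ j < suc (suc k) ] (- ∑[ l < suc k ] twoRowTerm M j l)
    ≡⟨ sum-neg (λ j → ∑[ l < suc k ] twoRowTerm M j l) ⟩
  - (∑[ j < suc (suc k) ] ∑[ l < suc k ] twoRowTerm M j l)
    ≡⟨ cong -_ (det′-expand₂ M) ⟨
  - det′ M ∎
  where open ≡-Reasoning
det′-swapRows {suc k} (suc c) M = trans
  (sum-cong-≗ λ j → trans (cong (λ d → sign j * (M zero j * d)) (det′-swapRows c (minor M j)))
                           (sym (neg-distribʳ-*² (sign j) (M zero j) (det′ (minor M j)))))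
  (sum-neg (λ j → sign j * (M zero j * det′ (minor M j))))

-- Deleting column adjSwap c j after swapping columns c and suc c: when j is one of
-- the two the swap disappears and the sign flips, otherwise the swap survives in the minor.
data AdjSwapPunchIn : (k : ℕ) → Fin (suc k) → Fin (suc (suc k)) → Set where
  hit  : ∀ {k c j} →
         (∀ x → adjSwap {k} c (punchIn (adjSwap c j) x) ≡ punchIn j x) →
         sign (adjSwap c j) ≡ - sign j → AdjSwapPunchIn k c j
  miss : ∀ {k c j} (c′ : Fin (suc k)) →
         (∀ x → adjSwap {suc k} c (punchIn (adjSwap c j) x) ≡ punchIn j (adjSwap c′ x)) →
         sign (adjSwap c j) ≡ sign j → AdjSwapPunchIn (suc k) c j

adjSwap-punchIn : ∀ {k} c j → AdjSwapPunchIn k c j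
adjSwap-punchIn         zero    zero          = hit (λ { zero → refl ; (suc x) → refl }) refl
adjSwap-punchIn         zero    (suc zero)    = hit (λ { zero → refl ; (suc x) → refl }) refl
adjSwap-punchIn {suc k} zero    (suc (suc j)) =
  miss zero (λ { zero → refl ; (suc zero) → refl ; (suc (suc x)) → refl }) refl
adjSwap-punchIn {suc k} (suc c) zero          = miss c (λ x → refl) refl
adjSwap-punchIn {suc k} (suc c) (suc j) with adjSwap-punchIn c j
... | hit  p s    = hit (λ { zero → refl ; (suc x) → cong suc (p x) }) (cong -_ s)
... | miss c′ p s = miss (suc c′) (λ { zero → refl ; (suc x) → cong suc (p x) }) (cong -_ s)

det′-swapCols : ∀ {k} (c : Fin (suc k)) (M : SqMatrix (suc (suc k))) →
  det′ (λ i → M i ∘ adjSwap c) ≡ - det′ M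
det′-swapCols {k} c M = begin
  sum swappedTerm                                ≡⟨ sum-adjSwap c swappedTerm ⟨
  ∑[ j < suc (suc k) ] swappedTerm (adjSwap c j) ≡⟨ sum-cong-≗ swappedTerm-adjSwap ⟩
  ∑[ j < suc (suc k) ] (- term j)                ≡⟨ sum-neg term ⟩
  - det′ M                                       ∎
  where
  open ≡-Reasoning
  swappedTerm term : Fin (suc (suc k)) → ℤ
  swappedTerm j = sign j * (M zero (adjSwap c j) * det′ (λ r x → M (suc r) (adjSwap c (punchIn j x))))
  term j = sign j * (M zero j * det′ (minor M j))
  swappedTerm-adjSwap : ∀ j → swappedTerm (adjSwap c j) ≡ - term j
  swappedTerm-adjSwap j with adjSwap-punchIn c j
  ... | hit p s = begin
    sign (adjSwap c j) * (M zero (adjSwap c (adjSwap c j)) * det′ (λ r x → M (suc r) (adjSwap c (punchIn (adjSwap c j) x))))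
      ≡⟨ cong₂ (λ s′ d → s′ * (M zero (adjSwap c (adjSwap c j)) * d)) s (det′-cong λ r x → cong (M (suc r)) (p x)) ⟩
    - sign j * (M zero (adjSwap c (adjSwap c j)) * det′ (minor M j))
      ≡⟨ cong (λ y → - sign j * (M zero y * det′ (minor M j))) (adjSwap-involutive c j) ⟩
    - sign j * (M zero j * det′ (minor M j))
      ≡⟨ ℤP.neg-distribˡ-* (sign j) _ ⟨
    - term j ∎
  ... | miss c′ p s = begin
    sign (adjSwap c j) * (M zero (adjSwap c (adjSwap c j)) * det′ (λ r x → M (suc r) (adjSwap c (punchIn (adjSwap c j) x))))
      ≡⟨ cong₂ (λ s′ d → s′ * (M zero (adjSwap c (adjSwap c j)) * d)) s (det′-cong λ r x → cong (M (suc r)) (p x)) ⟩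
    sign j * (M zero (adjSwap c (adjSwap c j)) * det′ (λ r → minor M j r ∘ adjSwap c′))
      ≡⟨ cong₂ (λ y d → sign j * (M zero y * d)) (adjSwap-involutive c j) (det′-swapCols c′ (minor M j)) ⟩
    sign j * (M zero j * - det′ (minor M j))
      ≡⟨ neg-distribʳ-*² (sign j) (M zero j) (det′ (minor M j)) ⟨
    - term j ∎

det′-swap : ∀ {k} (c : Fin (suc k)) (M : SqMatrix (suc (suc k))) →
  det′ (λ i j → M (adjSwap c i) (adjSwap c j)) ≡ det′ M
det′-swap c M = begin
  det′ (λ i j → M (adjSwap c i) (adjSwap c j)) ≡⟨ det′-swapRows c (λ i → M i ∘ adjSwap c) ⟩
  - det′ (λ i → M i ∘ adjSwap c)               ≡⟨ cong -_ (det′-swapCols c M) ⟩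
  - - det′ M                                   ≡⟨ ℤP.neg-involutive (det′ M) ⟩
  det′ M                                       ∎
  where open ≡-Reasoning

punchIn-↑ˡ : ∀ {m} n (j : Fin (suc m)) (c : Fin m) → punchIn (j ↑ˡ n) (c ↑ˡ n) ≡ punchIn j c ↑ˡ n
punchIn-↑ˡ n zero    c       = refl
punchIn-↑ˡ n (suc j) zero    = refl
punchIn-↑ˡ n (suc j) (suc c) = cong suc (punchIn-↑ˡ n j c)

punchIn-↑ʳ : ∀ m {n} (j : Fin (suc m)) (c : Fin n) → punchIn (j ↑ˡ n) (m ↑ʳ c) ≡ suc m ↑ʳ c
punchIn-↑ʳ m       zero    c = refl
punchIn-↑ʳ (suc m) (suc j) c = cong suc (punchIn-↑ʳ m j c)

sign-↑ˡ : ∀ {m} n (j : Fin m) → sign (j ↑ˡ n) ≡ sign j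
sign-↑ˡ n zero    = refl
sign-↑ˡ n (suc j) = cong -_ (sign-↑ˡ n j)

det′-blockTriangular : ∀ m n (M : SqMatrix (m ℕ.+ n)) → (∀ i j → M (i ↑ˡ n) (m ↑ʳ j) ≡ 0ℤ) →
  det′ M ≡ det′ (λ i j → M (i ↑ˡ n) (j ↑ˡ n)) * det′ (λ i j → M (m ↑ʳ i) (m ↑ʳ j))
det′-blockTriangular zero    n M zeroBlock = sym (ℤP.*-identityˡ _)
det′-blockTriangular (suc m) n M zeroBlock = begin
  sum term                                                    ≡⟨ sum-↑ (suc m) n term ⟩
  ∑[ j < suc m ] term (j ↑ˡ n) + ∑[ j < n ] term (suc m ↑ʳ j) ≡⟨ cong₂ _+_ (sum-cong-≗ leftTerm) (sum-zero _ rightTerm) ⟩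
  ∑[ j < suc m ] (upperTerm j * lowerDet) + 0ℤ                ≡⟨ ℤP.+-identityʳ _ ⟩
  ∑[ j < suc m ] (upperTerm j * lowerDet)                     ≡⟨ *-distribʳ-sum lowerDet upperTerm ⟨
  det′ (λ i j → M (i ↑ˡ n) (j ↑ˡ n)) * lowerDet               ∎
  where
  open ≡-Reasoning
  term : Fin (suc m ℕ.+ n) → ℤ
  term j = sign j * (M zero j * det′ (minor M j))
  lowerDet : ℤ
  lowerDet = det′ (λ i j → M (suc m ↑ʳ i) (suc m ↑ʳ j))
  upperTerm : Fin (suc m) → ℤ
  upperTerm j = sign j * (M zero (j ↑ˡ n) * det′ (minor (λ r c → M (r ↑ˡ n) (c ↑ˡ n)) j))
  leftTerm : ∀ j → term (j ↑ˡ n) ≡ upperTerm j * lowerDet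
  leftTerm j = begin
    sign (j ↑ˡ n) * (M zero (j ↑ˡ n) * det′ (minor M (j ↑ˡ n)))
      ≡⟨ cong₂ (λ s d → s * (M zero (j ↑ˡ n) * d)) (sign-↑ˡ n j)
           (det′-blockTriangular m n (minor M (j ↑ˡ n))
             (λ r c → trans (cong (M (suc r ↑ˡ n)) (punchIn-↑ʳ m j c)) (zeroBlock (suc r) c))) ⟩
    sign j * (M zero (j ↑ˡ n) * (det′ (λ r c → M (suc (r ↑ˡ n)) (punchIn (j ↑ˡ n) (c ↑ˡ n)))
                                  * det′ (λ r c → M (suc (m ↑ʳ r)) (punchIn (j ↑ˡ n) (m ↑ʳ c)))))
      ≡⟨ cong₂ (λ a b → sign j * (M zero (j ↑ˡ n) * (a * b)))
           (det′-cong λ r c → cong (M (suc r ↑ˡ n)) (punchIn-↑ˡ n j c))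
           (det′-cong λ r c → cong (M (suc m ↑ʳ r)) (punchIn-↑ʳ m j c)) ⟩
    sign j * (M zero (j ↑ˡ n) * (det′ (minor (λ r c → M (r ↑ˡ n) (c ↑ˡ n)) j) * lowerDet))
      ≡⟨ reassoc (sign j) (M zero (j ↑ˡ n)) _ lowerDet ⟩
    upperTerm j * lowerDet ∎
    where reassoc : ∀ a b c d → a * (b * (c * d)) ≡ a * (b * c) * d
          reassoc = solve-∀
  rightTerm : ∀ j → term (suc m ↑ʳ j) ≡ 0ℤ
  rightTerm j rewrite zeroBlock zero j = ℤP.*-zeroʳ (sign (suc m ↑ʳ j))

-- Determinants of the matrices [κ xᵢ xⱼ] of lists

gramDet : {A : Set} → (A → A → ℕ) → List A → ℤ
gramDet κ L = det′ (λ i j → + κ (lookup L i) (lookup L j))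

det′-cast : ∀ {m n} (eq : m ≡ n) (M : SqMatrix n) → det′ M ≡ det′ (λ i j → M (cast eq i) (cast eq j))
det′-cast refl M = det′-cong λ i j → sym (cong₂ M (FinP.cast-is-id refl i) (FinP.cast-is-id refl j))

lookup-map-cast : ∀ {A B : Set} (h : A → B) (L : List A) .(eq : length L ≡ length (map h L)) i →
  lookup (map h L) (cast eq i) ≡ h (lookup L i)
lookup-map-cast h (x ∷ L) eq zero    = refl
lookup-map-cast h (x ∷ L) eq (suc i) = lookup-map-cast h L (ℕP.suc-injective eq) i

lookup-++-↑ˡ : ∀ {A : Set} (L₀ L₁ : List A) .(eq : length L₀ ℕ.+ length L₁ ≡ length (L₀ ++ L₁)) i →
  lookup (L₀ ++ L₁) (cast eq (i ↑ˡ length L₁)) ≡ lookup L₀ i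
lookup-++-↑ˡ (x ∷ L₀) L₁ eq zero    = refl
lookup-++-↑ˡ (x ∷ L₀) L₁ eq (suc i) = lookup-++-↑ˡ L₀ L₁ (ℕP.suc-injective eq) i

lookup-++-↑ʳ : ∀ {A : Set} (L₀ L₁ : List A) .(eq : length L₀ ℕ.+ length L₁ ≡ length (L₀ ++ L₁)) j →
  lookup (L₀ ++ L₁) (cast eq (length L₀ ↑ʳ j)) ≡ lookup L₁ j
lookup-++-↑ʳ []       L₁ eq j = cong (lookup L₁) (FinP.cast-is-id eq j)
lookup-++-↑ʳ (x ∷ L₀) L₁ eq j = lookup-++-↑ʳ L₀ L₁ (ℕP.suc-injective eq) j

gramDet-map : ∀ {A B : Set} (κ : A → A → ℕ) (κ′ : B → B → ℕ) (h : A → B) →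
  (∀ a b → κ′ (h a) (h b) ≡ κ a b) → ∀ L → gramDet κ′ (map h L) ≡ gramDet κ L
gramDet-map κ κ′ h preserves L = trans (det′-cast eq _) (det′-cong λ i j → cong +_
  (trans (cong₂ κ′ (lookup-map-cast h L eq i) (lookup-map-cast h L eq j)) (preserves _ _)))
  where
  eq : length L ≡ length (map h L)
  eq = sym (LP.length-map h L)

gramDet-++ : ∀ {A : Set} (κ : A → A → ℕ) (L₀ L₁ : List A) →
  (∀ {a b} → a ∈ L₀ → b ∈ L₁ → κ a b ≡ 0) → gramDet κ (L₀ ++ L₁) ≡ gramDet κ L₀ * gramDet κ L₁
gramDet-++ {A} κ L₀ L₁ orthogonal = begin
  gramDet κ (L₀ ++ L₁)
    ≡⟨ det′-cast eq _ ⟩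
  det′ (λ i j → + κ (entry i) (entry j))
    ≡⟨ det′-blockTriangular (length L₀) (length L₁) (λ i j → + κ (entry i) (entry j)) (λ i j → cong +_
         (trans (cong₂ κ (lookup-++-↑ˡ L₀ L₁ eq i) (lookup-++-↑ʳ L₀ L₁ eq j)) (orthogonal (∈-lookup i) (∈-lookup j)))) ⟩
  det′ (λ i j → + κ (entry (i ↑ˡ length L₁)) (entry (j ↑ˡ length L₁)))
    * det′ (λ i j → + κ (entry (length L₀ ↑ʳ i)) (entry (length L₀ ↑ʳ j)))
    ≡⟨ cong₂ _*_ (det′-cong λ i j → cong +_ (cong₂ κ (lookup-++-↑ˡ L₀ L₁ eq i) (lookup-++-↑ˡ L₀ L₁ eq j)))
                 (det′-cong λ i j → cong +_ (cong₂ κ (lookup-++-↑ʳ L₀ L₁ eq i) (lookup-++-↑ʳ L₀ L₁ eq j))) ⟩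
  gramDet κ L₀ * gramDet κ L₁ ∎
  where
  open ≡-Reasoning
  eq : length L₀ ℕ.+ length L₁ ≡ length (L₀ ++ L₁)
  eq = sym (LP.length-++ L₀)
  entry : Fin (length L₀ ℕ.+ length L₁) → A
  entry i = lookup (L₀ ++ L₁) (cast eq i)

lookup-adjSwap : ∀ {A : Set} (pre : List A) x y L
  .(eq : length (pre ++ x ∷ y ∷ L) ≡ suc (suc (length pre ℕ.+ length L)))
  .(eq′ : length (pre ++ y ∷ x ∷ L) ≡ suc (suc (length pre ℕ.+ length L))) i →
  lookup (pre ++ x ∷ y ∷ L) (cast (sym eq) (adjSwap (Fin.fromℕ (length pre) ↑ˡ length L) i))
    ≡ lookup (pre ++ y ∷ x ∷ L) (cast (sym eq′) i)
lookup-adjSwap []        x y L eq eq′ zero          = refl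
lookup-adjSwap []        x y L eq eq′ (suc zero)    = refl
lookup-adjSwap []        x y L eq eq′ (suc (suc i)) = refl
lookup-adjSwap (a ∷ pre) x y L eq eq′ zero          = refl
lookup-adjSwap (a ∷ pre) x y L eq eq′ (suc i)       =
  lookup-adjSwap pre x y L (ℕP.suc-injective eq) (ℕP.suc-injective eq′) i

gramDet-adjSwap : ∀ {A : Set} (κ : A → A → ℕ) (pre : List A) x y L →
  gramDet κ (pre ++ x ∷ y ∷ L) ≡ gramDet κ (pre ++ y ∷ x ∷ L)
gramDet-adjSwap {A} κ pre x y L = begin
  gramDet κ (pre ++ x ∷ y ∷ L)                  ≡⟨ det′-cast (sym (length-++-∷∷ x y)) _ ⟩
  det′ M                                        ≡⟨ det′-swap c M ⟨
  det′ (λ i j → M (adjSwap c i) (adjSwap c j))  ≡⟨ det′-cong (λ i j → cong +_ (cong₂ κ (swapped i) (swapped j))) ⟩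
  det′ (λ i j → + κ (entry′ i) (entry′ j))      ≡⟨ det′-cast (sym (length-++-∷∷ y x)) _ ⟨
  gramDet κ (pre ++ y ∷ x ∷ L)                  ∎
  where
  open ≡-Reasoning
  length-++-∷∷ : ∀ a b → length (pre ++ a ∷ b ∷ L) ≡ suc (suc (length pre ℕ.+ length L))
  length-++-∷∷ a b = trans (LP.length-++ pre) (trans (ℕP.+-suc _ _) (cong suc (ℕP.+-suc _ _)))
  c : Fin (suc (length pre ℕ.+ length L))
  c = Fin.fromℕ (length pre) ↑ˡ length L
  entry′ : Fin (suc (suc (length pre ℕ.+ length L))) → A
  entry′ i = lookup (pre ++ y ∷ x ∷ L) (cast (sym (length-++-∷∷ y x)) i)
  M : SqMatrix (suc (suc (length pre ℕ.+ length L)))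
  M i j = + κ (lookup (pre ++ x ∷ y ∷ L) (cast (sym (length-++-∷∷ x y)) i))
              (lookup (pre ++ x ∷ y ∷ L) (cast (sym (length-++-∷∷ x y)) j))
  swapped : ∀ i → lookup (pre ++ x ∷ y ∷ L) (cast (sym (length-++-∷∷ x y)) (adjSwap c i)) ≡ entry′ i
  swapped = lookup-adjSwap pre x y L (length-++-∷∷ x y) (length-++-∷∷ y x)

gramDet-↭ : ∀ {A : Set} (κ : A → A → ℕ) {L L′ : List A} → L ↭ L′ → gramDet κ L ≡ gramDet κ L′
gramDet-↭ κ L↭L′ = prefixed L↭L′ []
  where
  prefixed : ∀ {L L′} → L ↭ L′ → ∀ pre → gramDet κ (pre ++ L) ≡ gramDet κ (pre ++ L′)
  prefixed ↭.refl pre = refl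
  prefixed (↭.prep {xs} {ys} x p) pre = begin
    gramDet κ (pre ++ x ∷ xs)             ≡⟨ cong (gramDet κ) (LP.++-assoc pre List.[ x ] xs) ⟨
    gramDet κ ((pre ++ List.[ x ]) ++ xs) ≡⟨ prefixed p (pre ++ List.[ x ]) ⟩
    gramDet κ ((pre ++ List.[ x ]) ++ ys) ≡⟨ cong (gramDet κ) (LP.++-assoc pre List.[ x ] ys) ⟩
    gramDet κ (pre ++ x ∷ ys)             ∎
    where open ≡-Reasoning
  prefixed (↭.swap {xs} {ys} x y p) pre = begin
    gramDet κ (pre ++ x ∷ y ∷ xs)          ≡⟨ cong (gramDet κ) (LP.++-assoc pre (x ∷ y ∷ []) xs) ⟨
    gramDet κ ((pre ++ x ∷ y ∷ []) ++ xs)  ≡⟨ prefixed p (pre ++ x ∷ y ∷ []) ⟩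
    gramDet κ ((pre ++ x ∷ y ∷ []) ++ ys)  ≡⟨ cong (gramDet κ) (LP.++-assoc pre (x ∷ y ∷ []) ys) ⟩
    gramDet κ (pre ++ x ∷ y ∷ ys)          ≡⟨ gramDet-adjSwap κ pre x y ys ⟩
    gramDet κ (pre ++ y ∷ x ∷ ys)          ∎
    where open ≡-Reasoning
  prefixed (↭.trans p q) pre = trans (prefixed p pre) (prefixed q pre)

-- Compositions with prescribed positive parts

concatMap-↭ : ∀ {A B : Set} {f g : A → List B} xs → (∀ x → f x ↭ g x) → concatMap f xs ↭ concatMap g xs
concatMap-↭ []       f↭g = ↭.↭-refl
concatMap-↭ (x ∷ xs) f↭g = ↭P.++⁺ (f↭g x) (concatMap-↭ xs f↭g)

concatMap-++-↭ : ∀ {A B : Set} (f g : A → List B) xs →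
  concatMap (λ x → f x ++ g x) xs ↭ concatMap f xs ++ concatMap g xs
concatMap-++-↭ f g []       = ↭.↭-refl
concatMap-++-↭ f g (x ∷ xs) = begin
  (f x ++ g x) ++ concatMap (λ x → f x ++ g x) xs  ≡⟨ LP.++-assoc (f x) (g x) _ ⟩
  f x ++ g x ++ concatMap (λ x → f x ++ g x) xs    ↭⟨ ↭P.++⁺ˡ (f x) (↭P.++⁺ˡ (g x) (concatMap-++-↭ f g xs)) ⟩
  f x ++ g x ++ concatMap f xs ++ concatMap g xs   ↭⟨ ↭P.++⁺ˡ (f x) (↭P.shifts (g x) (concatMap f xs)) ⟩
  f x ++ concatMap f xs ++ g x ++ concatMap g xs   ≡⟨ LP.++-assoc (f x) (concatMap f xs) _ ⟨
  (f x ++ concatMap f xs) ++ g x ++ concatMap g xs ∎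
  where open ↭.PermutationReasoning

-- compositions μ d lists the sequences of naturals summing to d whose i-th part is positive
-- where μ has true; B n d and Comp i d are its all-false and all-true cases (up to toList).
part : Bool → ℕ → ℕ
part false k = k
part true  k = suc k

partRange : Bool → ℕ → List ℕ
partRange false d = upTo (suc d)
partRange true  d = upTo d

compositions : List Bool → ℕ → List (List ℕ)
compositions []      zero    = [] ∷ []
compositions []      (suc d) = []
compositions (b ∷ μ) d =
  concatMap (λ k → map (part b k ∷_) (compositions μ (d ∸ part b k))) (partRange b d)

powProdL : List ℕ → List ℕ → ℕ
powProdL (a ∷ as) (b ∷ bs) = a ℕ.^ b ℕ.* powProdL as bs
powProdL _        _        = 1

insertZero : ℕ → List ℕ → List ℕ
insertZero zero    v       = 0 ∷ v
insertZero (suc t) []      = []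
insertZero (suc t) (x ∷ v) = x ∷ insertZero t v

PositiveAt : ℕ → List ℕ → Set
PositiveAt zero    (x ∷ _) = 1 ≤ x
PositiveAt (suc t) (_ ∷ v) = PositiveAt t v
PositiveAt _       []      = ⊥

powProdL-insertZero : ∀ t a b → powProdL (insertZero t a) (insertZero t b) ≡ powProdL a b
powProdL-insertZero zero    a       b       = ℕP.+-identityʳ _
powProdL-insertZero (suc t) []      b       = refl
powProdL-insertZero (suc t) (x ∷ a) []      = refl
powProdL-insertZero (suc t) (x ∷ a) (y ∷ b) = cong (x ℕ.^ y ℕ.*_) (powProdL-insertZero t a b)

powProdL-insertZero-positive : ∀ t a b → t ≤ length a → PositiveAt t b → powProdL (insertZero t a) b ≡ 0
powProdL-insertZero-positive zero    a       (suc y ∷ b) _         (s≤s z≤n) = refl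
powProdL-insertZero-positive (suc t) (x ∷ a) (y ∷ b)     (s≤s t≤n) pos       =
  trans (cong (x ℕ.^ y ℕ.*_) (powProdL-insertZero-positive t a b t≤n pos)) (ℕP.*-zeroʳ (x ℕ.^ y))

compositions-length : ∀ μ d → All (λ v → length v ≡ length μ) (compositions μ d)
compositions-length []      zero    = refl All.∷ All.[]
compositions-length []      (suc d) = All.[]
compositions-length (b ∷ μ) d = AllP.concat⁺ (AllP.map⁺ (All.universal
  (λ k → AllP.map⁺ (All.map (cong suc) (compositions-length μ (d ∸ part b k)))) (partRange b d)))

compositions-positiveAt : ∀ ν μ d → All (PositiveAt (length ν)) (compositions (ν ++ true ∷ μ) d)
compositions-positiveAt []      μ d = AllP.concat⁺ (AllP.map⁺ (All.universal
  (λ k → AllP.map⁺ (All.universal (λ _ → s≤s z≤n) (compositions μ (d ∸ suc k)))) (upTo d)))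
compositions-positiveAt (b ∷ ν) μ d = AllP.concat⁺ (AllP.map⁺ (All.universal
  (λ k → AllP.map⁺ (compositions-positiveAt ν μ (d ∸ part b k))) (partRange b d)))

concatMap-[] : ∀ {A B : Set} (f : A → List B) xs → (∀ x → f x ≡ []) → concatMap f xs ≡ []
concatMap-[] f []       f≗[] = refl
concatMap-[] f (x ∷ xs) f≗[] = trans (cong (_++ concatMap f xs) (f≗[] x)) (concatMap-[] f xs f≗[])

compositions-positive-empty : ∀ i d → d < i → compositions (replicate i true) d ≡ []
compositions-positive-empty (suc i) zero    _         = refl
compositions-positive-empty (suc i) (suc d) (s≤s d<i) = concatMap-[] _ (upTo (suc d)) λ k →
  cong (map (suc k ∷_)) (compositions-positive-empty i (d ∸ k) (ℕP.≤-<-trans (ℕP.m∸n≤m d k) d<i))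

compositions-split : ∀ ν μ d →
  compositions (ν ++ false ∷ μ) d ↭ map (insertZero (length ν)) (compositions (ν ++ μ) d) ++ compositions (ν ++ true ∷ μ) d
compositions-split []      μ d = ↭P.++⁺ˡ (map (0 ∷_) (compositions μ d)) (↭.↭-reflexive (cong List.concat
  (trans (LP.map-applyUpTo suc step d) (sym (LP.map-applyUpTo id (step ∘ suc) d)))))
  where
  step : ℕ → List (List ℕ)
  step k = map (k ∷_) (compositions μ (d ∸ k))
compositions-split (b ∷ ν) μ d = begin
  concatMap (λ k → map (p k ∷_) (compositions (ν ++ false ∷ μ) (d ∸ p k))) (partRange b d)
    ↭⟨ concatMap-↭ (partRange b d) (λ k → ↭P.map⁺ (p k ∷_) (compositions-split ν μ (d ∸ p k))) ⟩
  concatMap (λ k → map (p k ∷_) (map (insertZero t) (X k) ++ Y k)) (partRange b d)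
    ≡⟨ LP.concatMap-cong (λ k → LP.map-++ (p k ∷_) (map (insertZero t) (X k)) (Y k)) (partRange b d) ⟩
  concatMap (λ k → map (p k ∷_) (map (insertZero t) (X k)) ++ map (p k ∷_) (Y k)) (partRange b d)
    ↭⟨ concatMap-++-↭ (λ k → map (p k ∷_) (map (insertZero t) (X k))) (λ k → map (p k ∷_) (Y k)) (partRange b d) ⟩
  concatMap (λ k → map (p k ∷_) (map (insertZero t) (X k))) (partRange b d) ++ compositions ((b ∷ ν) ++ true ∷ μ) d
    ≡⟨ cong (_++ compositions ((b ∷ ν) ++ true ∷ μ) d) (LP.concatMap-cong (λ k → sym (LP.map-∘ (X k))) (partRange b d)) ⟩
  concatMap (λ k → map (insertZero (suc t) ∘ (p k ∷_)) (X k)) (partRange b d) ++ compositions ((b ∷ ν) ++ true ∷ μ) d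
    ≡⟨ cong (_++ compositions ((b ∷ ν) ++ true ∷ μ) d)
         (trans (LP.concatMap-cong (λ k → LP.map-∘ (X k)) (partRange b d))
                (sym (LP.map-concatMap (insertZero (suc t)) (λ k → map (p k ∷_) (X k)) (partRange b d)))) ⟩
  map (insertZero (suc t)) (compositions ((b ∷ ν) ++ μ) d) ++ compositions ((b ∷ ν) ++ true ∷ μ) d ∎
  where
  open ↭.PermutationReasoning
  t : ℕ
  t = length ν
  p : ℕ → ℕ
  p = part b
  X Y : ℕ → List (List ℕ)
  X k = compositions (ν ++ μ) (d ∸ p k)
  Y k = compositions (ν ++ true ∷ μ) (d ∸ p k)

compositionDet : List Bool → ℕ → ℤ
compositionDet μ d = gramDet powProdL (compositions μ d)

compositionDet-split : ∀ ν μ d →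
  compositionDet (ν ++ false ∷ μ) d ≡ compositionDet (ν ++ μ) d * compositionDet (ν ++ true ∷ μ) d
compositionDet-split ν μ d = begin
  gramDet powProdL (compositions (ν ++ false ∷ μ) d)     ≡⟨ gramDet-↭ powProdL (compositions-split ν μ d) ⟩
  gramDet powProdL (map (insertZero t) X ++ Y)           ≡⟨ gramDet-++ powProdL (map (insertZero t) X) Y orthogonal ⟩
  gramDet powProdL (map (insertZero t) X) * gramDet powProdL Y
    ≡⟨ cong (_* gramDet powProdL Y) (gramDet-map powProdL powProdL (insertZero t) (powProdL-insertZero t) X) ⟩
  gramDet powProdL X * gramDet powProdL Y                ∎
  where
  open ≡-Reasoning
  t : ℕ
  t = length ν
  X Y : List (List ℕ)
  X = compositions (ν ++ μ) d
  Y = compositions (ν ++ true ∷ μ) d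
  orthogonal : ∀ {a b} → a ∈ map (insertZero t) X → b ∈ Y → powProdL a b ≡ 0
  orthogonal a∈ b∈ with ∈-map⁻ (insertZero t) a∈
  ... | a , a∈X , refl = powProdL-insertZero-positive t a _
    (subst (t ≤_) (sym (trans (All.lookup (compositions-length (ν ++ μ) d) a∈X) (LP.length-++ ν))) (ℕP.m≤m+n t _))
    (All.lookup (compositions-positiveAt ν μ d) b∈)

-- Binomial products

prodUpTo : ℕ → (ℕ → ℤ) → ℤ
prodUpTo N f = prodℤ (applyUpTo f N)

prodUpTo-cong : ∀ N {f g : ℕ → ℤ} → (∀ j → f j ≡ g j) → prodUpTo N f ≡ prodUpTo N g
prodUpTo-cong zero    f≗g = refl
prodUpTo-cong (suc N) f≗g = cong₂ _*_ (f≗g 0) (prodUpTo-cong N (f≗g ∘ suc))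

prodUpTo-* : ∀ N (f g : ℕ → ℤ) → prodUpTo N (λ j → f j * g j) ≡ prodUpTo N f * prodUpTo N g
prodUpTo-* zero    f g = refl
prodUpTo-* (suc N) f g = trans (cong (f 0 * g 0 *_) (prodUpTo-* N (f ∘ suc) (g ∘ suc))) (interchange (f 0) (g 0) _ _)
  where interchange : ∀ a b c d → a * b * (c * d) ≡ a * c * (b * d)
        interchange = solve-∀

prodUpTo-ones : ∀ N (f : ℕ → ℤ) → (∀ j → f j ≡ 1ℤ) → prodUpTo N f ≡ 1ℤ
prodUpTo-ones zero    f f≗1 = refl
prodUpTo-ones (suc N) f f≗1 = cong₂ _*_ (f≗1 0) (prodUpTo-ones N (f ∘ suc) (f≗1 ∘ suc))

prodUpTo-+ : ∀ m n (f : ℕ → ℤ) → prodUpTo (m ℕ.+ n) f ≡ prodUpTo m f * prodUpTo n (λ j → f (m ℕ.+ j))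
prodUpTo-+ zero    n f = sym (ℤP.*-identityˡ _)
prodUpTo-+ (suc m) n f = trans (cong (f 0 *_) (prodUpTo-+ m n (f ∘ suc))) (sym (ℤP.*-assoc (f 0) _ _))

prodUpTo-⊓ : ∀ n K (f : ℕ → ℤ) → (∀ j → K ≤ j → f j ≡ 1ℤ) → prodUpTo n f ≡ prodUpTo (n ⊓ K) f
prodUpTo-⊓ n K f f≗1 with ℕP.≤-total n K
... | inj₁ n≤K = cong (λ m → prodUpTo m f) (sym (ℕP.m≤n⇒m⊓n≡m n≤K))
... | inj₂ K≤n = begin
  prodUpTo n f                                             ≡⟨ cong (λ m → prodUpTo m f) (ℕP.m+[n∸m]≡n K≤n) ⟨
  prodUpTo (K ℕ.+ (n ∸ K)) f                               ≡⟨ prodUpTo-+ K (n ∸ K) f ⟩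
  prodUpTo K f * prodUpTo (n ∸ K) (λ j → f (K ℕ.+ j))      ≡⟨ cong (prodUpTo K f *_) (prodUpTo-ones (n ∸ K) _ (λ j → f≗1 (K ℕ.+ j) (ℕP.m≤m+n K j))) ⟩
  prodUpTo K f * 1ℤ                                        ≡⟨ ℤP.*-identityʳ _ ⟩
  prodUpTo K f                                             ≡⟨ cong (λ m → prodUpTo m f) (ℕP.m≥n⇒m⊓n≡n K≤n) ⟨
  prodUpTo (n ⊓ K) f                                       ∎
  where open ≡-Reasoning

binomialProd : (ℕ → ℤ) → ℕ → ℕ → ℤ
binomialProd w z N = prodUpTo N (λ j → w j ^ (z C j))

binomialProd-pascal : ∀ (w : ℕ → ℤ) z N →
  binomialProd w (suc z) (suc N) ≡ binomialProd w z (suc N) * binomialProd (w ∘ suc) z N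
binomialProd-pascal w z N = begin
  w 0 ^ 1 * prodUpTo N (λ j → w (suc j) ^ (suc z C suc j))
    ≡⟨ cong (w 0 ^ 1 *_) (prodUpTo-cong N λ j → trans
         (cong (w (suc j) ^_) (sym (nCk+nC[k+1]≡[n+1]C[k+1] z j)))
         (ℤP.^-distribˡ-+-* (w (suc j)) (z C j) (z C suc j))) ⟩
  w 0 ^ 1 * prodUpTo N (λ j → w (suc j) ^ (z C j) * w (suc j) ^ (z C suc j))
    ≡⟨ cong (w 0 ^ 1 *_) (prodUpTo-* N _ _) ⟩
  w 0 ^ 1 * (binomialProd (w ∘ suc) z N * prodUpTo N (λ j → w (suc j) ^ (z C suc j)))
    ≡⟨ rearrange (w 0 ^ 1) _ _ ⟩
  binomialProd w z (suc N) * binomialProd (w ∘ suc) z N ∎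
  where
  open ≡-Reasoning
  rearrange : ∀ a b c → a * (b * c) ≡ a * c * b
  rearrange = solve-∀

replicate-++-∷ : ∀ {A : Set} t (x : A) xs → replicate t x ++ x ∷ xs ≡ replicate (suc t) x ++ xs
replicate-++-∷ zero    x xs = refl
replicate-++-∷ (suc t) x xs = cong (x ∷_) (replicate-++-∷ t x xs)

compositionDet-binomial : ∀ d t m N → m < N →
  compositionDet (replicate t true ++ replicate m false) d
    ≡ binomialProd (λ j → compositionDet (replicate (t ℕ.+ j) true) d) m N
compositionDet-binomial d t zero (suc N) _ = begin
  compositionDet (replicate t true ++ []) d             ≡⟨ cong (λ μ → compositionDet μ d) (LP.++-identityʳ (replicate t true)) ⟩
  compositionDet (replicate t true) d                   ≡⟨ cong (λ i → compositionDet (replicate i true) d) (ℕP.+-identityʳ t) ⟨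
  w 0                                                   ≡⟨ trans (cong (_* 1ℤ) (ℤP.^-identityʳ (w 0))) (ℤP.*-identityʳ (w 0)) ⟨
  w 0 ^ 1 * 1ℤ                                          ≡⟨ cong (w 0 ^ 1 *_) (prodUpTo-ones N (λ j → w (suc j) ^ (0 C suc j)) λ j → refl) ⟨
  binomialProd w 0 (suc N)                              ∎
  where
  open ≡-Reasoning
  w : ℕ → ℤ
  w j = compositionDet (replicate (t ℕ.+ j) true) d
compositionDet-binomial d t (suc m) (suc N) (s≤s m<N) = begin
  compositionDet (replicate t true ++ false ∷ replicate m false) d
    ≡⟨ compositionDet-split (replicate t true) (replicate m false) d ⟩
  compositionDet (replicate t true ++ replicate m false) d * compositionDet (replicate t true ++ true ∷ replicate m false) d
    ≡⟨ cong (λ μ → compositionDet (replicate t true ++ replicate m false) d * compositionDet μ d)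
         (replicate-++-∷ t true (replicate m false)) ⟩
  compositionDet (replicate t true ++ replicate m false) d * compositionDet (replicate (suc t) true ++ replicate m false) d
    ≡⟨ cong₂ _*_ (compositionDet-binomial d t m (suc N) (ℕP.m<n⇒m<1+n m<N)) (compositionDet-binomial d (suc t) m N m<N) ⟩
  binomialProd w m (suc N) * binomialProd (λ j → compositionDet (replicate (suc t ℕ.+ j) true) d) m N
    ≡⟨ cong (binomialProd w m (suc N) *_) (prodUpTo-cong N λ j →
         cong (λ i → compositionDet (replicate i true) d ^ (m C j)) (ℕP.+-suc t j)) ⟨
  binomialProd w m (suc N) * binomialProd (w ∘ suc) m N
    ≡⟨ binomialProd-pascal w m N ⟨
  binomialProd w (suc m) (suc N) ∎
  where
  open ≡-Reasoning
  w : ℕ → ℤ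
  w j = compositionDet (replicate (t ℕ.+ j) true) d

-- The matrices V and W

powProdL-toList : ∀ {n} (a b : Vec ℕ n) → powProdL (Vec.toList a) (Vec.toList b) ≡ powProd a b
powProdL-toList []      []      = refl
powProdL-toList (x ∷ a) (y ∷ b) = cong (x ℕ.^ y ℕ.*_) (powProdL-toList a b)

det-powMatrix : ∀ {n} (L : List (Vec ℕ n)) → det (length L) (powMatrix L) ≡ gramDet powProdL (map Vec.toList L)
det-powMatrix L = trans (det≡det′ (length L) (powMatrix L)) (sym (gramDet-map powProd powProdL Vec.toList powProdL-toList L))

map-toList-∷ : ∀ {n} k (X : List (Vec ℕ n)) → map Vec.toList (map (k ∷_) X) ≡ map (k ∷_) (map Vec.toList X)
map-toList-∷ k X = trans (sym (LP.map-∘ X)) (LP.map-∘ X)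

toList-B : ∀ n d → map Vec.toList (B n d) ≡ compositions (replicate n false) d
toList-B zero    zero    = refl
toList-B zero    (suc d) = refl
toList-B (suc n) d = trans (LP.map-concatMap Vec.toList _ (upTo (suc d))) (LP.concatMap-cong (λ k →
  trans (map-toList-∷ k (B n (d ∸ k))) (cong (map (k ∷_)) (toList-B n (d ∸ k)))) (upTo (suc d)))

toList-Comp : ∀ i d → map Vec.toList (Comp i d) ≡ compositions (replicate i true) d
toList-Comp zero    zero    = refl
toList-Comp zero    (suc d) = refl
toList-Comp (suc i) d = trans (LP.map-concatMap Vec.toList _ (upTo d)) (LP.concatMap-cong (λ k →
  trans (map-toList-∷ (suc k) (Comp i (d ∸ suc k))) (cong (map (suc k ∷_)) (toList-Comp i (d ∸ suc k)))) (upTo d))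

detV≡compositionDet : ∀ n d → detV n d ≡ compositionDet (replicate n false) d
detV≡compositionDet n d = trans (det-powMatrix (B n d)) (cong (gramDet powProdL) (toList-B n d))

detW≡compositionDet : ∀ i d → detW i d ≡ compositionDet (replicate i true) d
detW≡compositionDet i d = trans (det-powMatrix (Comp i d)) (cong (gramDet powProdL) (toList-Comp i d))

corollary2 : (n d : ℕ) → 1 ≤ n → 1 ≤ d →
    detV n d ≡ prodℤ (map (λ i → detW i d ^ (n C i)) (map suc (upTo (n ⊓ d))))
corollary2 n zero    _ ()
corollary2 n (suc d) _ _ = begin
  detV n D                                                        ≡⟨ detV≡compositionDet n D ⟩
  compositionDet (replicate n false) D                            ≡⟨ compositionDet-binomial D 0 n (suc n) ℕP.≤-refl ⟩
  binomialProd w n (suc n)                                        ≡⟨ ℤP.*-identityˡ _ ⟩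
  prodUpTo n (λ j → w (suc j) ^ (n C suc j))                      ≡⟨ prodUpTo-⊓ n D _ vanishing ⟩
  prodUpTo (n ⊓ D) (λ j → w (suc j) ^ (n C suc j))                ≡⟨ prodUpTo-cong (n ⊓ D) (λ j →
                                                                       cong (_^ (n C suc j)) (detW≡compositionDet (suc j) D)) ⟨
  prodUpTo (n ⊓ D) (λ j → detW (suc j) D ^ (n C suc j))           ≡⟨ cong prodℤ (trans
                                                                       (cong (map h) (LP.map-applyUpTo id suc (n ⊓ D)))
                                                                       (LP.map-applyUpTo suc h (n ⊓ D))) ⟨
  prodℤ (map h (map suc (upTo (n ⊓ D))))                          ∎
  where
  open ≡-Reasoning
  D : ℕ
  D = suc d
  w : ℕ → ℤ
  w i = compositionDet (replicate i true) D
  h : ℕ → ℤ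
  h i = detW i D ^ (n C i)
  vanishing : ∀ j → D ≤ j → w (suc j) ^ (n C suc j) ≡ 1ℤ
  vanishing j D≤j = trans (cong (λ L → gramDet powProdL L ^ (n C suc j)) (compositions-positive-empty (suc j) D (s≤s D≤j)))
                          (ℤP.^-zeroˡ (n C suc j))
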